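{- Let $G=\operatorname{GL}_2(\mathbb{Z}_2)$ and for $m\ge1$ let $\Gamma(2^m)=\ker(\operatorname{GL}_2(\mathbb{Z}_2)\to\operatorname{GL}_2(\mathbb{Z}/2^m\mathbb{Z}))$. Suppose $k\ge2$ and $H$ is a subgroup with $\Gamma(2^k)\subseteq H\subseteq G$. If $K$ is an open maximal subgroup of $H$, then $\Gamma(2^{k+1})\subseteq K$. -}

module Defs where

open import Data.Nat as ℕ using (ℕ; suc)
open import Data.Integer using (ℤ; +_; _+_; _*_; -_; _-_)
open import Data.Integer.Tactic.RingSolver using (solve-∀)
open import Data.Product using (Σ; _×_; _,_; ∃)
open import Data.Sum using (_⊎_)
open import Relation.Nullary using (¬_)
open import Relation.Binary.PropositionalEquality using (_≡_; refl)

infix 4 _≡[_]_ _≈_ _≈M_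
_≡[_]_ : ℤ → ℤ → ℤ → Set
a ≡[ m ] b = Σ ℤ λ q → a ≡ b + q * m

pow2 : ℕ → ℤ
pow2 n = + (2 ℕ.^ n)

-- The 2-adic integers ℤ₂ = lim ℤ/2^n, as coherent sequences of integer
-- representatives x n of the residue class mod 2^n.

record ℤ₂ : Set where
  constructor mkℤ₂
  field
    seq : ℕ → ℤ
    coh : ∀ n → seq (suc n) ≡[ pow2 n ] seq n
open ℤ₂ public

_≈_ : ℤ₂ → ℤ₂ → Set
x ≈ y = ∀ n → seq x n ≡[ pow2 n ] seq y n

private
  +-lem : ∀ a b q r m → (a + q * m) + (b + r * m) ≡ (a + b) + (q + r) * m
  +-lem = solve-∀
  *-lem : ∀ a b q r m → (a + q * m) * (b + r * m) ≡ (a * b) + (a * r + q * b + q * r * m) * m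
  *-lem = solve-∀
  neg-lem : ∀ a q m → - (a + q * m) ≡ (- a) + (- q) * m
  neg-lem = solve-∀
  c-lem : ∀ c m → c ≡ c + (+ 0) * m
  c-lem = solve-∀

const : ℤ → ℤ₂
const c = mkℤ₂ (λ _ → c) (λ n → + 0 , c-lem c (pow2 n))

0ℤ₂ 1ℤ₂ : ℤ₂
0ℤ₂ = const (+ 0)
1ℤ₂ = const (+ 1)

infixl 6 _⊕_
infixl 7 _⊗_
_⊕_ : ℤ₂ → ℤ₂ → ℤ₂
x ⊕ y = mkℤ₂ (λ n → seq x n + seq y n) pf
  where
  pf : ∀ n → (seq x (suc n) + seq y (suc n)) ≡[ pow2 n ] (seq x n + seq y n)
  pf n with coh x n | coh y n
  ... | q , eq₁ | r , eq₂ rewrite eq₁ | eq₂ =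
    q + r , +-lem (seq x n) (seq y n) q r (pow2 n)

⊖_ : ℤ₂ → ℤ₂
⊖ x = mkℤ₂ (λ n → - seq x n) pf
  where
  pf : ∀ n → (- seq x (suc n)) ≡[ pow2 n ] (- seq x n)
  pf n with coh x n
  ... | q , eq₁ rewrite eq₁ = - q , neg-lem (seq x n) q (pow2 n)

_⊗_ : ℤ₂ → ℤ₂ → ℤ₂
x ⊗ y = mkℤ₂ (λ n → seq x n * seq y n) pf
  where
  pf : ∀ n → (seq x (suc n) * seq y (suc n)) ≡[ pow2 n ] (seq x n * seq y n)
  pf n with coh x n | coh y n
  ... | q , eq₁ | r , eq₂ rewrite eq₁ | eq₂ =
    seq x n * r + q * seq y n + q * r * pow2 n , *-lem (seq x n) (seq y n) q r (pow2 n)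

record M2 : Set where
  constructor mat2
  field
    a b c d : ℤ₂
open M2 public

_≈M_ : M2 → M2 → Set
A ≈M B = (a A ≈ a B) × (b A ≈ b B) × (c A ≈ c B) × (d A ≈ d B)

_·M_ : M2 → M2 → M2
A ·M B = mat2 ((a A ⊗ a B) ⊕ (b A ⊗ c B)) ((a A ⊗ b B) ⊕ (b A ⊗ d B))
              ((c A ⊗ a B) ⊕ (d A ⊗ c B)) ((c A ⊗ b B) ⊕ (d A ⊗ d B))

I2 : M2
I2 = mat2 1ℤ₂ 0ℤ₂ 0ℤ₂ 1ℤ₂

det : M2 → ℤ₂
det A = (a A ⊗ d A) ⊕ (⊖ (b A ⊗ c A))

IsUnit : ℤ₂ → Set
IsUnit z = Σ ℤ₂ λ u → (z ⊗ u) ≈ 1ℤ₂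

record GL₂ℤ₂ : Set where
  constructor mkGL
  field
    mat : M2
    detUnit : IsUnit (det mat)
open GL₂ℤ₂ public

_⊆_ : (GL₂ℤ₂ → Set) → (GL₂ℤ₂ → Set) → Set
P ⊆ Q = ∀ g → P g → Q g

-- Since equality in G is the setoid equality ≈M,
-- "the product g·h lies in H" is stated for every element of G whose
-- matrix equals the matrix product, and likewise for the identity and
-- for inverses (h is an inverse of g iff g·h = 1).
record IsSubgroup (H : GL₂ℤ₂ → Set) : Set where
  field
    one : ∀ e → mat e ≈M I2 → H e
    mul : ∀ g h gh → H g → H h → mat gh ≈M (mat g ·M mat h) → H gh
    inv : ∀ g h → H g → (mat g ·M mat h) ≈M I2 → H h

Γ : ℕ → GL₂ℤ₂ → Set
Γ m g = (seq (a (mat g)) m ≡[ pow2 m ] + 1) × (seq (b (mat g)) m ≡[ pow2 m ] + 0)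
      × (seq (c (mat g)) m ≡[ pow2 m ] + 0) × (seq (d (mat g)) m ≡[ pow2 m ] + 1)

-- A subgroup K of the profinite group G is open iff it contains some
-- member Γ(2^n) of the basis of open neighbourhoods of the identity.
IsOpenSubgroup : (GL₂ℤ₂ → Set) → Set
IsOpenSubgroup K = IsSubgroup K × Σ ℕ λ n → Γ n ⊆ K

IsMaximalSubgroupOf : (GL₂ℤ₂ → Set) → (GL₂ℤ₂ → Set) → Set₁
IsMaximalSubgroupOf K H =
  IsSubgroup K × K ⊆ H × (Σ GL₂ℤ₂ λ g → H g × ¬ K g)
  × (∀ (L : GL₂ℤ₂ → Set) → IsSubgroup L → K ⊆ L → L ⊆ H → (L ⊆ K) ⊎ (H ⊆ L))

{-# OPTIONS --safe #-}
-- Let L = H ∩ K·Γ(2ᵏ⁺¹). It is a subgroup with K ⊆ L ⊆ H, so by maximality either L ⊆ K,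
-- which already gives Γ(2ᵏ⁺¹) ⊆ K, or H ⊆ L, so that Γ(2ᵏ) ⊆ K·Γ(2ᵏ⁺¹). The second case is
-- refuted by a square-root argument: for p ≥ 2,
--   (I + 2ᵖB + 2ᵖ⁺¹C)² ≡ I + 2ᵖ⁺¹B  (mod 2ᵖ⁺²),
-- so every element of Γ(2ᵖ⁺¹) is congruent mod 2ᵖ⁺² to the square of anything congruent
-- mod 2ᵖ⁺¹ to the element I + 2ᵖB of Γ(2ᵖ). Hence Γ(2ᵖ) ⊆ K·Γ(2ᵖ⁺¹) propagates from p = k
-- to all p ≥ k, and K·Γ(2ᵏ⁺¹) = K·Γ(2ⁿ) for all n > k. As K is open, this is K itself,
-- so H ⊆ K, contradicting properness.
module Submission where

open import Defs
open import Data.Nat as ℕ using (ℕ; zero; suc; _≤_; s≤s; z≤n; _≤′_; ≤′-refl; ≤′-step)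
open import Data.Nat.Properties using (≤-trans; ≤′⇒≤; ≤′-trans; m≤′m+n; n≤′m+n)
import Data.Nat.Properties as ℕ
open import Data.Integer using (ℤ; +_; _+_; _*_; -_; _^_)
open import Data.Integer.Properties using (pos-*)
open import Data.Integer.Tactic.RingSolver using (solve; solve-∀)
open import Data.Empty using (⊥-elim)
open import Data.List using (_∷_; [])
open import Data.Product using (Σ; _×_; _,_; proj₁; proj₂)
open import Data.Sum using (inj₁; inj₂)
open import Function using (_∘_)
open import Relation.Binary.Bundles using (Setoid)
import Relation.Binary.Reasoning.Setoid as SetoidReasoning
open import Relation.Binary.PropositionalEquality
open import Relation.Unary using (_∩_)

infix 4 _≋[_]_

-- Defs' congruence wrapped in a record, so that its indices can be inferred.
record _≋[_]_ (x m y : ℤ) : Set where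
  constructor ⟪_⟫
  field unwrap : x ≡[ m ] y
open _≋[_]_

variable
  x x′ y y′ z m r : ℤ
  n p : ℕ

≋-reflexive : x ≡ y → x ≋[ m ] y
≋-reflexive {x} {m = m} refl = ⟪ + 0 , solve (x ∷ m ∷ []) ⟫

≋-refl : x ≋[ m ] x
≋-refl = ≋-reflexive refl

≋-sym : x ≋[ m ] y → y ≋[ m ] x
≋-sym {m = m} {y} ⟪ q , refl ⟫ = ⟪ - q , solve (y ∷ q ∷ m ∷ []) ⟫

≋-trans : x ≋[ m ] y → y ≋[ m ] z → x ≋[ m ] z
≋-trans {m = m} {z = z} ⟪ q , refl ⟫ ⟪ q′ , refl ⟫ = ⟪ q′ + q , solve (z ∷ q ∷ q′ ∷ m ∷ []) ⟫

+-cong-≋ : x ≋[ m ] x′ → y ≋[ m ] y′ → x + y ≋[ m ] x′ + y′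
+-cong-≋ {m = m} {x′} {y′ = y′} ⟪ q , refl ⟫ ⟪ q′ , refl ⟫ =
  ⟪ q + q′ , solve (x′ ∷ y′ ∷ q ∷ q′ ∷ m ∷ []) ⟫

*-cong-≋ : x ≋[ m ] x′ → y ≋[ m ] y′ → x * y ≋[ m ] x′ * y′
*-cong-≋ {m = m} {x′} {y′ = y′} ⟪ q , refl ⟫ ⟪ q′ , refl ⟫ =
  ⟪ x′ * q′ + q * y′ + q * q′ * m , solve (x′ ∷ y′ ∷ q ∷ q′ ∷ m ∷ []) ⟫

≋-weaken : x ≋[ m * r ] y → x ≋[ m ] y
≋-weaken {m = m} {r} {y} ⟪ q , refl ⟫ = ⟪ q * r , solve (y ∷ q ∷ m ∷ r ∷ []) ⟫

pow2-suc : ∀ n → pow2 (suc n) ≡ pow2 n * + 2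
pow2-suc n = trans (cong +_ (ℕ.*-comm 2 (2 ℕ.^ n))) (pos-* (2 ℕ.^ n) 2)

record Mℤ : Set where
  constructor mℤ
  field e₁₁ e₁₂ e₂₁ e₂₂ : ℤ
open Mℤ

variable
  A A′ B B′ C : Mℤ

1ᴹ : Mℤ
1ᴹ = mℤ (+ 1) (+ 0) (+ 0) (+ 1)

infixl 6 _+ᴹ_
infixl 7 _*ᴹ_ _⋆_

_+ᴹ_ : Mℤ → Mℤ → Mℤ
A +ᴹ B = mℤ (e₁₁ A + e₁₁ B) (e₁₂ A + e₁₂ B) (e₂₁ A + e₂₁ B) (e₂₂ A + e₂₂ B)

_⋆_ : Mℤ → ℤ → Mℤ
A ⋆ s = mℤ (e₁₁ A * s) (e₁₂ A * s) (e₂₁ A * s) (e₂₂ A * s)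

_*ᴹ_ : Mℤ → Mℤ → Mℤ
A *ᴹ B = mℤ (e₁₁ A * e₁₁ B + e₁₂ A * e₂₁ B) (e₁₁ A * e₁₂ B + e₁₂ A * e₂₂ B)
            (e₂₁ A * e₁₁ B + e₂₂ A * e₂₁ B) (e₂₁ A * e₁₂ B + e₂₂ A * e₂₂ B)

detᴹ : Mℤ → ℤ
detᴹ A = e₁₁ A * e₂₂ A + - (e₁₂ A * e₂₁ A)

adjᴹ : Mℤ → Mℤ
adjᴹ A = mℤ (e₂₂ A) (- e₁₂ A) (- e₂₁ A) (e₁₁ A)

mℤ-cong : ∀ {a a′ b b′ c c′ d d′} → a ≡ a′ → b ≡ b′ → c ≡ c′ → d ≡ d′ →
  mℤ a b c d ≡ mℤ a′ b′ c′ d′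
mℤ-cong refl refl refl refl = refl

*ᴹ-assoc : ∀ A B C → (A *ᴹ B) *ᴹ C ≡ A *ᴹ (B *ᴹ C)
*ᴹ-assoc (mℤ a b c d) (mℤ e f g h) (mℤ i j k l) =
  mℤ-cong (row a b i k) (row a b j l) (row c d i k) (row c d j l)
  where
  row : ∀ x y u v → (x * e + y * g) * u + (x * f + y * h) * v ≡ x * (e * u + f * v) + y * (g * u + h * v)
  row x y u v = solve (x ∷ y ∷ u ∷ v ∷ e ∷ f ∷ g ∷ h ∷ [])

*ᴹ-identityˡ : ∀ A → 1ᴹ *ᴹ A ≡ A
*ᴹ-identityˡ (mℤ a b c d) = mℤ-cong (first a c) (first b d) (second a c) (second b d)
  where
  first : ∀ x y → + 1 * x + + 0 * y ≡ x
  first = solve-∀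
  second : ∀ x y → + 0 * x + + 1 * y ≡ y
  second = solve-∀

*ᴹ-identityʳ : ∀ A → A *ᴹ 1ᴹ ≡ A
*ᴹ-identityʳ (mℤ a b c d) = mℤ-cong (first a b) (second a b) (first c d) (second c d)
  where
  first : ∀ x y → x * + 1 + y * + 0 ≡ x
  first = solve-∀
  second : ∀ x y → x * + 0 + y * + 1 ≡ y
  second = solve-∀

*ᴹ-adjᴹ : ∀ A s → A *ᴹ (adjᴹ A ⋆ s) ≡ 1ᴹ ⋆ (detᴹ A * s)
*ᴹ-adjᴹ (mℤ a b c d) s = mℤ-cong diagonal₁ off-diagonal₁ off-diagonal₂ diagonal₂
  where
  diagonal₁ : a * (d * s) + b * (- c * s) ≡ + 1 * ((a * d + - (b * c)) * s)
  diagonal₁ = solve (a ∷ b ∷ c ∷ d ∷ s ∷ [])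
  off-diagonal₁ : a * (- b * s) + b * (a * s) ≡ + 0 * ((a * d + - (b * c)) * s)
  off-diagonal₁ = solve (a ∷ b ∷ c ∷ d ∷ s ∷ [])
  off-diagonal₂ : c * (d * s) + d * (- c * s) ≡ + 0 * ((a * d + - (b * c)) * s)
  off-diagonal₂ = solve (a ∷ b ∷ c ∷ d ∷ s ∷ [])
  diagonal₂ : c * (- b * s) + d * (a * s) ≡ + 1 * ((a * d + - (b * c)) * s)
  diagonal₂ = solve (a ∷ b ∷ c ∷ d ∷ s ∷ [])

detᴹ-*ᴹ : ∀ A B → detᴹ (A *ᴹ B) ≡ detᴹ A * detᴹ B
detᴹ-*ᴹ (mℤ a b c d) (mℤ e f g h) = identity
  where
  identity : (a * e + b * g) * (c * f + d * h) + - ((a * f + b * h) * (c * e + d * g))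
           ≡ (a * d + - (b * c)) * (e * h + - (f * g))
  identity = solve (a ∷ b ∷ c ∷ d ∷ e ∷ f ∷ g ∷ h ∷ [])

detᴹ-adjᴹ⋆ : ∀ A s → detᴹ (adjᴹ A ⋆ s) ≡ detᴹ A * (s * s)
detᴹ-adjᴹ⋆ (mℤ a b c d) s = identity
  where
  identity : d * s * (a * s) + - (- b * s * (- c * s)) ≡ (a * d + - (b * c)) * (s * s)
  identity = solve (a ∷ b ∷ c ∷ d ∷ s ∷ [])

detᴹ-1ᴹ+even : ∀ B t → detᴹ (1ᴹ +ᴹ B ⋆ (t * + 2)) ≡[ + 2 ] + 1
detᴹ-1ᴹ+even (mℤ a b c d) t = a * t + d * t + (a * d + - (b * c)) * t * t * + 2 , identity
  where
  identity : (+ 1 + a * (t * + 2)) * (+ 1 + d * (t * + 2)) + - ((+ 0 + b * (t * + 2)) * (+ 0 + c * (t * + 2)))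
           ≡ + 1 + (a * t + d * t + (a * d + - (b * c)) * t * t * + 2) * + 2
  identity = solve (a ∷ b ∷ c ∷ d ∷ t ∷ [])

square-1ᴹ+ : ∀ D s → (1ᴹ +ᴹ D ⋆ s) *ᴹ (1ᴹ +ᴹ D ⋆ s) ≡ 1ᴹ +ᴹ (D +ᴹ D +ᴹ D *ᴹ D ⋆ s) ⋆ s
square-1ᴹ+ (mℤ a b c d) s = mℤ-cong entry₁₁ entry₁₂ entry₂₁ entry₂₂
  where
  entry₁₁ : (+ 1 + a * s) * (+ 1 + a * s) + (+ 0 + b * s) * (+ 0 + c * s)
          ≡ + 1 + (a + a + (a * a + b * c) * s) * s
  entry₁₁ = solve (a ∷ b ∷ c ∷ d ∷ s ∷ [])
  entry₁₂ : (+ 1 + a * s) * (+ 0 + b * s) + (+ 0 + b * s) * (+ 1 + d * s)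
          ≡ + 0 + (b + b + (a * b + b * d) * s) * s
  entry₁₂ = solve (a ∷ b ∷ c ∷ d ∷ s ∷ [])
  entry₂₁ : (+ 0 + c * s) * (+ 1 + a * s) + (+ 1 + d * s) * (+ 0 + c * s)
          ≡ + 0 + (c + c + (c * a + d * c) * s) * s
  entry₂₁ = solve (a ∷ b ∷ c ∷ d ∷ s ∷ [])
  entry₂₂ : (+ 0 + c * s) * (+ 0 + b * s) + (+ 1 + d * s) * (+ 1 + d * s)
          ≡ + 1 + (d + d + (c * b + d * d) * s) * s
  entry₂₂ = solve (a ∷ b ∷ c ∷ d ∷ s ∷ [])

infix 4 _≋ᴹ[_]_
record _≋ᴹ[_]_ (A : Mℤ) (m : ℤ) (B : Mℤ) : Set where
  constructor entrywise
  field
    ≋₁₁ : e₁₁ A ≋[ m ] e₁₁ B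
    ≋₁₂ : e₁₂ A ≋[ m ] e₁₂ B
    ≋₂₁ : e₂₁ A ≋[ m ] e₂₁ B
    ≋₂₂ : e₂₂ A ≋[ m ] e₂₂ B
open _≋ᴹ[_]_

≋ᴹ-reflexive : A ≡ B → A ≋ᴹ[ m ] B
≋ᴹ-reflexive refl = entrywise (≋-reflexive refl) (≋-reflexive refl) (≋-reflexive refl) (≋-reflexive refl)

≋ᴹ-refl : A ≋ᴹ[ m ] A
≋ᴹ-refl = ≋ᴹ-reflexive refl

≋ᴹ-sym : A ≋ᴹ[ m ] B → B ≋ᴹ[ m ] A
≋ᴹ-sym (entrywise p q r s) = entrywise (≋-sym p) (≋-sym q) (≋-sym r) (≋-sym s)

≋ᴹ-trans : A ≋ᴹ[ m ] B → B ≋ᴹ[ m ] C → A ≋ᴹ[ m ] C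
≋ᴹ-trans (entrywise p q r s) (entrywise p′ q′ r′ s′) =
  entrywise (≋-trans p p′) (≋-trans q q′) (≋-trans r r′) (≋-trans s s′)

≋ᴹ-setoid : ℤ → Setoid _ _
≋ᴹ-setoid m = record
  { Carrier = Mℤ
  ; _≈_ = _≋ᴹ[ m ]_
  ; isEquivalence = record { refl = ≋ᴹ-refl ; sym = ≋ᴹ-sym ; trans = ≋ᴹ-trans }
  }

*ᴹ-cong : A ≋ᴹ[ m ] A′ → B ≋ᴹ[ m ] B′ → A *ᴹ B ≋ᴹ[ m ] A′ *ᴹ B′
*ᴹ-cong (entrywise p q r s) (entrywise p′ q′ r′ s′) = entrywise
  (+-cong-≋ (*-cong-≋ p p′) (*-cong-≋ q r′)) (+-cong-≋ (*-cong-≋ p q′) (*-cong-≋ q s′))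
  (+-cong-≋ (*-cong-≋ r p′) (*-cong-≋ s r′)) (+-cong-≋ (*-cong-≋ r q′) (*-cong-≋ s s′))

⋆-cong : ∀ A → x ≋[ m ] y → A ⋆ x ≋ᴹ[ m ] A ⋆ y
⋆-cong A x≋y = entrywise (*-cong-≋ (≋-refl {e₁₁ A}) x≋y) (*-cong-≋ (≋-refl {e₁₂ A}) x≋y)
                         (*-cong-≋ (≋-refl {e₂₁ A}) x≋y) (*-cong-≋ (≋-refl {e₂₂ A}) x≋y)

≋ᴹ-weaken : A ≋ᴹ[ m * r ] B → A ≋ᴹ[ m ] B
≋ᴹ-weaken (entrywise p q r s) = entrywise (≋-weaken p) (≋-weaken q) (≋-weaken r) (≋-weaken s)

≋ᴹ-witness : A ≋ᴹ[ m ] B → Σ Mℤ λ C → A ≡ B +ᴹ C ⋆ m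
≋ᴹ-witness (entrywise ⟪ q₁₁ , p ⟫ ⟪ q₁₂ , q ⟫ ⟪ q₂₁ , r ⟫ ⟪ q₂₂ , s ⟫) =
  mℤ q₁₁ q₁₂ q₂₁ q₂₂ , mℤ-cong p q r s

-- A = I + qD with D = B + 2C, so A² = I + q(2D + qD²) ≡ I + 2qB (mod 4q) because 4 ∣ q.
square-≋ : ∀ {t q m m′} → q ≡ t * + 2 * + 2 → m ≡ q * + 2 → m′ ≡ m * + 2 →
  A ≋ᴹ[ m ] 1ᴹ +ᴹ B ⋆ q → A *ᴹ A ≋ᴹ[ m′ ] 1ᴹ +ᴹ B ⋆ m
square-≋ {B = B} {t} refl refl refl A≋ with ≋ᴹ-witness A≋
... | C , refl = ≋ᴹ-trans (≋ᴹ-reflexive (trans (cong (λ W → W *ᴹ W) regroup) (square-1ᴹ+ D q))) reduce-mod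
  where
  q : ℤ
  q = t * + 2 * + 2
  D : Mℤ
  D = B +ᴹ C ⋆ + 2
  regroup-entry : ∀ δ b c s → δ + b * s + c * (s * + 2) ≡ δ + (b + c * + 2) * s
  regroup-entry = solve-∀
  regroup : 1ᴹ +ᴹ B ⋆ q +ᴹ C ⋆ (q * + 2) ≡ 1ᴹ +ᴹ D ⋆ q
  regroup = mℤ-cong (regroup-entry (+ 1) (e₁₁ B) (e₁₁ C) q) (regroup-entry (+ 0) (e₁₂ B) (e₁₂ C) q)
                    (regroup-entry (+ 0) (e₂₁ B) (e₂₁ C) q) (regroup-entry (+ 1) (e₂₂ B) (e₂₂ C) q)
  -- The let makes q visible to the ring solver, which treats defined names as opaque constants.
  reduce-entry : ∀ δ b c e → let q = t * + 2 * + 2 in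
    δ + ((b + c * + 2) + (b + c * + 2) + e * q) * q ≋[ q * + 2 * + 2 ] δ + b * (q * + 2)
  reduce-entry δ b c e = ⟪ c + e * t , solve (δ ∷ b ∷ c ∷ e ∷ t ∷ []) ⟫
  reduce-mod : 1ᴹ +ᴹ (D +ᴹ D +ᴹ D *ᴹ D ⋆ q) ⋆ q ≋ᴹ[ q * + 2 * + 2 ] 1ᴹ +ᴹ B ⋆ (q * + 2)
  reduce-mod = entrywise (reduce-entry (+ 1) (e₁₁ B) (e₁₁ C) (e₁₁ (D *ᴹ D)))
                         (reduce-entry (+ 0) (e₁₂ B) (e₁₂ C) (e₁₂ (D *ᴹ D)))
                         (reduce-entry (+ 0) (e₂₁ B) (e₂₁ C) (e₂₁ (D *ᴹ D)))
                         (reduce-entry (+ 1) (e₂₂ B) (e₂₂ C) (e₂₂ (D *ᴹ D)))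

square-≋-pow2 : 2 ≤ p → A ≋ᴹ[ pow2 (suc p) ] 1ᴹ +ᴹ B ⋆ pow2 p →
  A *ᴹ A ≋ᴹ[ pow2 (suc (suc p)) ] 1ᴹ +ᴹ B ⋆ pow2 (suc p)
square-≋-pow2 {suc (suc s)} {A} {B} (s≤s (s≤s z≤n)) =
  square-≋ {A} {B} {t = pow2 s}
    (trans (pow2-suc (suc s)) (cong (_* + 2) (pow2-suc s)))
    (pow2-suc (suc (suc s)))
    (pow2-suc (suc (suc (suc s))))

reduce : ℕ → M2 → Mℤ
reduce n M = mℤ (seq (a M) n) (seq (b M) n) (seq (c M) n) (seq (d M) n)

reduce-coherent : ∀ n M → reduce (suc n) M ≋ᴹ[ pow2 n ] reduce n M
reduce-coherent n M = entrywise ⟪ coh (a M) n ⟫ ⟪ coh (b M) n ⟫ ⟪ coh (c M) n ⟫ ⟪ coh (d M) n ⟫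

≈M⇒≋ᴹ : ∀ {M M′} → M ≈M M′ → reduce n M ≋ᴹ[ pow2 n ] reduce n M′
≈M⇒≋ᴹ (a≈ , b≈ , c≈ , d≈) = entrywise ⟪ a≈ _ ⟫ ⟪ b≈ _ ⟫ ⟪ c≈ _ ⟫ ⟪ d≈ _ ⟫

≋ᴹ⇒≈M : ∀ {M M′} → (∀ n → reduce n M ≋ᴹ[ pow2 n ] reduce n M′) → M ≈M M′
≋ᴹ⇒≈M M≋M′ = (λ n → unwrap (≋₁₁ (M≋M′ n))) , (λ n → unwrap (≋₁₂ (M≋M′ n)))
            , (λ n → unwrap (≋₂₁ (M≋M′ n))) , (λ n → unwrap (≋₂₂ (M≋M′ n)))

-- The inverse of 1 + 2q is the 2-adic geometric series ∑ (-q)ⁱ 2ⁱ.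
odd-isUnit : ∀ {u} → u ≡[ + 2 ] + 1 → IsUnit (const u)
odd-isUnit (q , refl) = mkℤ₂ partial (λ n → (- q) ^ n , refl) , λ n → unwrap (inverse n)
  where
  partial : ℕ → ℤ
  partial zero = + 0
  partial (suc n) = partial n + (- q) ^ n * pow2 n
  step : ∀ S s P → (+ 1 + q * + 2) * (S + s * P) + - q * s * (P * + 2) ≡ (+ 1 + q * + 2) * S + s * P
  step S s P = solve (S ∷ s ∷ P ∷ q ∷ [])
  invariant : ∀ n → (+ 1 + q * + 2) * partial n + (- q) ^ n * pow2 n ≡ + 1
  invariant zero = solve (q ∷ [])
  invariant (suc n) = begin
    (+ 1 + q * + 2) * (partial n + (- q) ^ n * pow2 n) + - q * (- q) ^ n * pow2 (suc n)
      ≡⟨ cong (λ P → (+ 1 + q * + 2) * (partial n + (- q) ^ n * pow2 n) + - q * (- q) ^ n * P) (pow2-suc n) ⟩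
    (+ 1 + q * + 2) * (partial n + (- q) ^ n * pow2 n) + - q * (- q) ^ n * (pow2 n * + 2)
      ≡⟨ step (partial n) ((- q) ^ n) (pow2 n) ⟩
    (+ 1 + q * + 2) * partial n + (- q) ^ n * pow2 n
      ≡⟨ invariant n ⟩
    + 1 ∎
    where open ≡-Reasoning
  inverse : ∀ n → (+ 1 + q * + 2) * partial n ≋[ pow2 n ] + 1
  inverse n = ≋-trans (≋-sym ⟪ (- q) ^ n , refl ⟫) (≋-reflexive (invariant n))

isUnit-≋ : ∀ z (z-unit : IsUnit z) n → seq z n * seq (proj₁ z-unit) n ≋[ pow2 n ] + 1
isUnit-≋ _ (_ , zu≈1) n = ⟪ zu≈1 n ⟫

det-·M-isUnit : ∀ {M M′} → IsUnit (det M) → IsUnit (det M′) → IsUnit (det (M ·M M′))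
det-·M-isUnit {M} {M′} M-unit@(u , _) M′-unit@(v , _) = u ⊗ v , λ n →
  unwrap (≋-trans (≋-reflexive (regroup n))
                  (*-cong-≋ (isUnit-≋ (det M) M-unit n) (isUnit-≋ (det M′) M′-unit n)))
  where
  interchange : ∀ x y z w → x * y * (z * w) ≡ x * z * (y * w)
  interchange = solve-∀
  regroup : ∀ n → detᴹ (reduce n M *ᴹ reduce n M′) * (seq u n * seq v n)
                ≡ detᴹ (reduce n M) * seq u n * (detᴹ (reduce n M′) * seq v n)
  regroup n = trans (cong (_* (seq u n * seq v n)) (detᴹ-*ᴹ (reduce n M) (reduce n M′)))
                    (interchange (detᴹ (reduce n M)) (detᴹ (reduce n M′)) (seq u n) (seq v n))

-- The group GL₂(ℤ₂) modulo 2ⁿ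

variable
  g g′ h h′ κ : GL₂ℤ₂

ε : GL₂ℤ₂
ε = mkGL I2 (1ℤ₂ , λ n → unwrap ≋-refl)

infix 4 _∼[_]_
record _∼[_]_ (g : GL₂ℤ₂) (n : ℕ) (h : GL₂ℤ₂) : Set where
  constructor reduce-≋
  field ≋-reduce : reduce n (mat g) ≋ᴹ[ pow2 n ] reduce n (mat h)
open _∼[_]_

∼-refl : g ∼[ n ] g
∼-refl = reduce-≋ ≋ᴹ-refl

∼-sym : g ∼[ n ] h → h ∼[ n ] g
∼-sym (reduce-≋ p) = reduce-≋ (≋ᴹ-sym p)

∼-trans : g ∼[ n ] h → h ∼[ n ] κ → g ∼[ n ] κ
∼-trans (reduce-≋ p) (reduce-≋ q) = reduce-≋ (≋ᴹ-trans p q)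

∼-setoid : ℕ → Setoid _ _
∼-setoid n = record
  { Carrier = GL₂ℤ₂
  ; _≈_ = _∼[ n ]_
  ; isEquivalence = record { refl = ∼-refl ; sym = ∼-sym ; trans = ∼-trans }
  }

module ∼-Reasoning (n : ℕ) = SetoidReasoning (∼-setoid n)

≈M⇒∼ : mat g ≈M mat h → g ∼[ n ] h
≈M⇒∼ {g} {h} g≈h = reduce-≋ (≈M⇒≋ᴹ {M = mat g} {M′ = mat h} g≈h)

∼⇒≈M : (∀ n → g ∼[ n ] h) → mat g ≈M mat h
∼⇒≈M {g} {h} g∼h = ≋ᴹ⇒≈M {mat g} {mat h} (≋-reduce ∘ g∼h)

∼-weaken : g ∼[ suc n ] h → g ∼[ n ] h
∼-weaken {g} {n} {h} (reduce-≋ g≋h) = reduce-≋ (begin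
  reduce n (mat g)          ≈⟨ reduce-coherent n (mat g) ⟨
  reduce (suc n) (mat g)    ≈⟨ ≋ᴹ-weaken g≋h′ ⟩
  reduce (suc n) (mat h)    ≈⟨ reduce-coherent n (mat h) ⟩
  reduce n (mat h)          ∎)
  where
  open SetoidReasoning (≋ᴹ-setoid (pow2 n))
  g≋h′ : reduce (suc n) (mat g) ≋ᴹ[ pow2 n * + 2 ] reduce (suc n) (mat h)
  g≋h′ = subst (reduce (suc n) (mat g) ≋ᴹ[_] reduce (suc n) (mat h)) (pow2-suc n) g≋h

-- Products and inverses are opaque: otherwise the unifier, when solving g ∙ ?h against
-- g ∙ h, unfolds both sides into ℤ-arithmetic instead of comparing the factors.
opaque
  infixl 7 _∙_
  _∙_ : GL₂ℤ₂ → GL₂ℤ₂ → GL₂ℤ₂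
  g ∙ h = mkGL (mat g ·M mat h) (det-·M-isUnit {mat g} {mat h} (detUnit g) (detUnit h))

  -- u = (det M)⁻¹ is put on the right so that reduce n gives adjᴹ (reduce n M) ⋆ seq u n.
  infix 8 _⁻¹
  _⁻¹ : GL₂ℤ₂ → GL₂ℤ₂
  g ⁻¹ = mkGL (mat2 (d M ⊗ u) ((⊖ b M) ⊗ u) ((⊖ c M) ⊗ u) (a M ⊗ u)) (det M , λ n →
    unwrap (≋-trans (≋-reflexive (regroup n))
                    (*-cong-≋ (isUnit-≋ (det M) (detUnit g) n) (isUnit-≋ (det M) (detUnit g) n))))
    where
    M : M2
    M = mat g
    u : ℤ₂
    u = proj₁ (detUnit g)
    square : ∀ x y → x * (y * y) * x ≡ x * y * (x * y)
    square = solve-∀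
    regroup : ∀ n → detᴹ (adjᴹ (reduce n M) ⋆ seq u n) * detᴹ (reduce n M)
                  ≡ detᴹ (reduce n M) * seq u n * (detᴹ (reduce n M) * seq u n)
    regroup n = trans (cong (_* detᴹ (reduce n M)) (detᴹ-adjᴹ⋆ (reduce n M) (seq u n)))
                      (square (detᴹ (reduce n M)) (seq u n))

  mat-∙ : ∀ g h → mat (g ∙ h) ≡ mat g ·M mat h
  mat-∙ g h = refl

  ∙-cong : g ∼[ n ] g′ → h ∼[ n ] h′ → g ∙ h ∼[ n ] g′ ∙ h′
  ∙-cong (reduce-≋ p) (reduce-≋ q) = reduce-≋ (*ᴹ-cong p q)

  ∙-congˡ : ∀ g → h ∼[ n ] h′ → g ∙ h ∼[ n ] g ∙ h′
  ∙-congˡ {n = n} g (reduce-≋ p) = reduce-≋ (*ᴹ-cong (≋ᴹ-refl {reduce n (mat g)}) p)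

  ∙-congʳ : ∀ h → g ∼[ n ] g′ → g ∙ h ∼[ n ] g′ ∙ h
  ∙-congʳ {n = n} h (reduce-≋ p) = reduce-≋ (*ᴹ-cong p (≋ᴹ-refl {reduce n (mat h)}))

  ∙-assoc : ∀ g h κ → (g ∙ h) ∙ κ ∼[ n ] g ∙ (h ∙ κ)
  ∙-assoc {n} g h κ =
    reduce-≋ (≋ᴹ-reflexive (*ᴹ-assoc (reduce n (mat g)) (reduce n (mat h)) (reduce n (mat κ))))

  ∙-identityˡ : ∀ g → ε ∙ g ∼[ n ] g
  ∙-identityˡ {n} g = reduce-≋ (≋ᴹ-reflexive (*ᴹ-identityˡ (reduce n (mat g))))

  ∙-identityʳ : ∀ g → g ∙ ε ∼[ n ] g
  ∙-identityʳ {n} g = reduce-≋ (≋ᴹ-reflexive (*ᴹ-identityʳ (reduce n (mat g))))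

  ⁻¹-inverseʳ : ∀ g → g ∙ g ⁻¹ ∼[ n ] ε
  ⁻¹-inverseʳ {n} g = reduce-≋ (≋ᴹ-trans
    (≋ᴹ-reflexive (*ᴹ-adjᴹ (reduce n (mat g)) (seq (proj₁ (detUnit g)) n)))
    (⋆-cong 1ᴹ (isUnit-≋ (det (mat g)) (detUnit g) n)))

-- In a monoid in which every element has a right inverse, right inverses are also left inverses.
⁻¹-inverseˡ : ∀ g → g ⁻¹ ∙ g ∼[ n ] ε
⁻¹-inverseˡ {n} g = begin
  g ⁻¹ ∙ g                 ≈⟨ ∙-congˡ (g ⁻¹) g∼g⁻¹⁻¹ ⟩
  g ⁻¹ ∙ g ⁻¹ ⁻¹           ≈⟨ ⁻¹-inverseʳ (g ⁻¹) ⟩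
  ε                        ∎
  where
  open ∼-Reasoning n
  g∼g⁻¹⁻¹ : g ∼[ n ] g ⁻¹ ⁻¹
  g∼g⁻¹⁻¹ = begin
    g                        ≈⟨ ∙-identityʳ g ⟨
    g ∙ ε                    ≈⟨ ∙-congˡ g (⁻¹-inverseʳ (g ⁻¹)) ⟨
    g ∙ (g ⁻¹ ∙ g ⁻¹ ⁻¹)     ≈⟨ ∙-assoc g (g ⁻¹) (g ⁻¹ ⁻¹) ⟨
    g ∙ g ⁻¹ ∙ g ⁻¹ ⁻¹       ≈⟨ ∙-congʳ (g ⁻¹ ⁻¹) (⁻¹-inverseʳ g) ⟩
    ε ∙ g ⁻¹ ⁻¹              ≈⟨ ∙-identityˡ (g ⁻¹ ⁻¹) ⟩
    g ⁻¹ ⁻¹                  ∎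

inverse-unique : g ∙ h ∼[ n ] ε → h ∼[ n ] g ⁻¹
inverse-unique {g} {h} {n} gh∼ε = begin
  h                  ≈⟨ ∙-identityˡ h ⟨
  ε ∙ h              ≈⟨ ∙-congʳ h (⁻¹-inverseˡ g) ⟨
  g ⁻¹ ∙ g ∙ h       ≈⟨ ∙-assoc (g ⁻¹) g h ⟩
  g ⁻¹ ∙ (g ∙ h)     ≈⟨ ∙-congˡ (g ⁻¹) gh∼ε ⟩
  g ⁻¹ ∙ ε           ≈⟨ ∙-identityʳ (g ⁻¹) ⟩
  g ⁻¹               ∎
  where open ∼-Reasoning n

⁻¹-cong : g ∼[ n ] h → g ⁻¹ ∼[ n ] h ⁻¹
⁻¹-cong {g} {h = h} g∼h =
  inverse-unique {h} {g ⁻¹} (∼-trans (∙-congʳ (g ⁻¹) (∼-sym g∼h)) (⁻¹-inverseʳ g))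

⁻¹∙∼ε : g ∼[ n ] κ → κ ⁻¹ ∙ g ∼[ n ] ε
⁻¹∙∼ε {κ = κ} g∼κ = ∼-trans (∙-congˡ (κ ⁻¹) g∼κ) (⁻¹-inverseˡ κ)

∙⁻¹∙-cancel : ∀ κ g → κ ∙ (κ ⁻¹ ∙ g) ∼[ n ] g
∙⁻¹∙-cancel {n} κ g = begin
  κ ∙ (κ ⁻¹ ∙ g)   ≈⟨ ∙-assoc κ (κ ⁻¹) g ⟨
  κ ∙ κ ⁻¹ ∙ g     ≈⟨ ∙-congʳ g (⁻¹-inverseʳ κ) ⟩
  ε ∙ g            ≈⟨ ∙-identityˡ g ⟩
  g                ∎
  where open ∼-Reasoning n

Γ⇒∼ε : Γ n g → g ∼[ n ] ε
Γ⇒∼ε (p , q , r , s) = reduce-≋ (entrywise ⟪ p ⟫ ⟪ q ⟫ ⟪ r ⟫ ⟪ s ⟫)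

∼ε⇒Γ : g ∼[ n ] ε → Γ n g
∼ε⇒Γ (reduce-≋ (entrywise p q r s)) = unwrap p , unwrap q , unwrap r , unwrap s

Γ-suc⊆ : Γ (suc n) ⊆ Γ n
Γ-suc⊆ {n} g = ∼ε⇒Γ ∘ ∼-weaken ∘ Γ⇒∼ε {suc n} {g}

Γ-antitone : ∀ {n′} → n′ ≤′ n → Γ n ⊆ Γ n′
Γ-antitone ≤′-refl = λ g γ → γ
Γ-antitone (≤′-step n′≤n) g = Γ-antitone n′≤n g ∘ Γ-suc⊆ g

constᴹ : Mℤ → M2
constᴹ A = mat2 (const (e₁₁ A)) (const (e₁₂ A)) (const (e₂₁ A)) (const (e₂₂ A))

constGL : (A : Mℤ) → detᴹ A ≡[ + 2 ] + 1 → GL₂ℤ₂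
constGL A odd = mkGL (constᴹ A) (odd-isUnit odd)

Γ-square-root : ∀ {y} → 2 ≤ p → Γ (suc p) y →
  Σ GL₂ℤ₂ λ root → Γ p root × (∀ κ → root ∼[ suc p ] κ → y ∼[ suc (suc p) ] κ ∙ κ)
Γ-square-root {suc s} {y} 2≤p γ
  with ≋ᴹ-witness (≋ᴹ-trans (reduce-coherent (suc (suc s)) (mat y)) (≋-reduce (Γ⇒∼ε {suc (suc s)} {y} γ)))
... | B , y≡ = root , Γ-root , squares
  where
  root : GL₂ℤ₂
  root = constGL (1ᴹ +ᴹ B ⋆ pow2 (suc s))
    (subst (λ P → detᴹ (1ᴹ +ᴹ B ⋆ P) ≡[ + 2 ] + 1) (sym (pow2-suc s)) (detᴹ-1ᴹ+even B (pow2 s)))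
  Γ-root : Γ (suc s) root
  Γ-root = (e₁₁ B , refl) , (e₁₂ B , refl) , (e₂₁ B , refl) , (e₂₂ B , refl)
  squares : ∀ κ → root ∼[ suc (suc s) ] κ → y ∼[ suc (suc (suc s)) ] κ ∙ κ
  squares κ (reduce-≋ root≋κ) = reduce-≋ (begin
    reduce N (mat y)                       ≡⟨ y≡ ⟩
    1ᴹ +ᴹ B ⋆ pow2 (suc (suc s))           ≈⟨ square-≋-pow2 {B = B} 2≤p κ≋root ⟨
    reduce N (mat κ) *ᴹ reduce N (mat κ)   ≡⟨ cong (reduce N) (mat-∙ κ κ) ⟨
    reduce N (mat (κ ∙ κ))                 ∎)
    where
    N : ℕ
    N = suc (suc (suc s))
    κ≋root : reduce N (mat κ) ≋ᴹ[ pow2 (suc (suc s)) ] 1ᴹ +ᴹ B ⋆ pow2 (suc s)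
    κ≋root = ≋ᴹ-trans (reduce-coherent (suc (suc s)) (mat κ)) (≋ᴹ-sym root≋κ)
    open SetoidReasoning (≋ᴹ-setoid (pow2 N))

module _ {K : GL₂ℤ₂ → Set} (K-sub : IsSubgroup K) where
  open IsSubgroup K-sub

  ε-closed : K ε
  ε-closed = one ε (∼⇒≈M {ε} {ε} (λ _ → ∼-refl))

  ∙-closed : K g → K h → K (g ∙ h)
  ∙-closed {g} {h} Kg Kh =
    mul g h (g ∙ h) Kg Kh (subst (mat (g ∙ h) ≈M_) (mat-∙ g h) (∼⇒≈M {g ∙ h} {g ∙ h} (λ _ → ∼-refl)))

  ⁻¹-closed : K g → K (g ⁻¹)
  ⁻¹-closed {g} Kg =
    inv g (g ⁻¹) Kg (subst (_≈M I2) (mat-∙ g (g ⁻¹)) (∼⇒≈M {g ∙ g ⁻¹} {ε} (λ _ → ⁻¹-inverseʳ g)))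

  ∼-closed : (∀ n → g ∼[ n ] h) → K h → K g
  ∼-closed {g} {h} g∼h Kh = mul h ε g Kh ε-closed
    (subst (mat g ≈M_) (mat-∙ h ε) (∼⇒≈M {g} {h ∙ ε} (λ n → ∼-trans (g∼h n) (∼-sym (∙-identityʳ h)))))

∩-isSubgroup : ∀ {H L} → IsSubgroup H → IsSubgroup L → IsSubgroup (H ∩ L)
∩-isSubgroup H-sub L-sub = record
  { one = λ e e≈I → H.one e e≈I , L.one e e≈I
  ; mul = λ { g h gh (Hg , Lg) (Hh , Lh) gh≈ → H.mul g h gh Hg Hh gh≈ , L.mul g h gh Lg Lh gh≈ }
  ; inv = λ { g h (Hg , Lg) gh≈I → H.inv g h Hg gh≈I , L.inv g h Lg gh≈I }
  }
  where
  module H = IsSubgroup H-sub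
  module L = IsSubgroup L-sub

-- K ·Γ n is the product set K·Γ(2ⁿ).
infix 25 _·Γ_
_·Γ_ : (GL₂ℤ₂ → Set) → ℕ → GL₂ℤ₂ → Set
(K ·Γ n) g = Σ GL₂ℤ₂ λ κ → K κ × g ∼[ n ] κ

·Γ-isSubgroup : ∀ {K} → IsSubgroup K → IsSubgroup (K ·Γ n)
·Γ-isSubgroup {n} K-sub = record
  { one = λ e e≈I → ε , ε-closed K-sub , ≈M⇒∼ {e} {ε} e≈I
  ; mul = λ { g h gh (κ , Kκ , g∼κ) (κ′ , Kκ′ , h∼κ′) gh≈ →
      κ ∙ κ′ , ∙-closed K-sub Kκ Kκ′ ,
      ∼-trans (≈M⇒∼ {gh} {g ∙ h} (subst (mat gh ≈M_) (sym (mat-∙ g h)) gh≈)) (∙-cong g∼κ h∼κ′) }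
  ; inv = λ { g h (κ , Kκ , g∼κ) gh≈I →
      κ ⁻¹ , ⁻¹-closed K-sub Kκ ,
      ∼-trans (inverse-unique {g} {h} (≈M⇒∼ {g ∙ h} {ε} (subst (_≈M I2) (sym (mat-∙ g h)) gh≈I)))
              (⁻¹-cong g∼κ) }
  }

-- Open subgroups absorbing Γ(2ᵖ)

module _ {K : GL₂ℤ₂ → Set} (K-sub : IsSubgroup K) where

  Γ⊆·Γ-step : 2 ≤ p → Γ p ⊆ K ·Γ suc p → Γ (suc p) ⊆ K ·Γ suc (suc p)
  Γ⊆·Γ-step 2≤p Γp⊆ y γ =
    let root , Γ-root , squares = Γ-square-root 2≤p γ
        κ , Kκ , root∼κ = Γp⊆ root Γ-root
    in κ ∙ κ , ∙-closed K-sub Kκ Kκ , squares κ root∼κ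

  Γ⊆·Γ-above : ∀ {q} → 2 ≤ p → Γ p ⊆ K ·Γ suc p → p ≤′ q → Γ q ⊆ K ·Γ suc q
  Γ⊆·Γ-above 2≤p Γp⊆ ≤′-refl = Γp⊆
  Γ⊆·Γ-above 2≤p Γp⊆ (≤′-step p≤q) = Γ⊆·Γ-step (≤-trans 2≤p (≤′⇒≤ p≤q)) (Γ⊆·Γ-above 2≤p Γp⊆ p≤q)

  ·Γ⊆·Γ-suc : Γ n ⊆ K ·Γ suc n → K ·Γ n ⊆ K ·Γ suc n
  ·Γ⊆·Γ-suc Γn⊆ g (κ , Kκ , g∼κ) =
    let κ′ , Kκ′ , κ⁻¹g∼κ′ = Γn⊆ (κ ⁻¹ ∙ g) (∼ε⇒Γ (⁻¹∙∼ε g∼κ))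
    in κ ∙ κ′ , ∙-closed K-sub Kκ Kκ′ , ∼-trans (∼-sym (∙⁻¹∙-cancel κ g)) (∙-congˡ κ κ⁻¹g∼κ′)

  ·Γ⊆·Γ-above : 2 ≤ p → Γ p ⊆ K ·Γ suc p → suc p ≤′ n → K ·Γ suc p ⊆ K ·Γ n
  ·Γ⊆·Γ-above 2≤p Γp⊆ ≤′-refl g = λ g∈ → g∈
  ·Γ⊆·Γ-above 2≤p Γp⊆ (≤′-step p<n) g =
    ·Γ⊆·Γ-suc (Γ⊆·Γ-above 2≤p Γp⊆ (≤′-trans (≤′-step ≤′-refl) p<n)) g ∘ ·Γ⊆·Γ-above 2≤p Γp⊆ p<n g

  ·Γ⊆ : Γ n ⊆ K → K ·Γ n ⊆ K
  ·Γ⊆ Γn⊆K g (κ , Kκ , g∼κ) = ∼-closed K-sub (λ _ → ∼-sym (∙⁻¹∙-cancel κ g))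
    (∙-closed K-sub Kκ (Γn⊆K (κ ⁻¹ ∙ g) (∼ε⇒Γ (⁻¹∙∼ε g∼κ))))

  ·Γ-collapses : ∀ {n₀} → Γ n₀ ⊆ K → 2 ≤ p → Γ p ⊆ K ·Γ suc p → K ·Γ suc p ⊆ K
  ·Γ-collapses {p} {n₀} Γn₀⊆K 2≤p Γp⊆ g = ·Γ⊆ Γn⊆K g ∘ ·Γ⊆·Γ-above 2≤p Γp⊆ (n≤′m+n n₀ (suc p)) g
    where
    Γn⊆K : Γ (n₀ ℕ.+ suc p) ⊆ K
    Γn⊆K g = Γn₀⊆K g ∘ Γ-antitone (m≤′m+n n₀ (suc p)) g

mainTheorem5 : (k : ℕ) → 2 ≤ k → (H : GL₂ℤ₂ → Set) → IsSubgroup H → Γ k ⊆ H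
    → (K : GL₂ℤ₂ → Set) → IsOpenSubgroup K → IsMaximalSubgroupOf K H
    → Γ (suc k) ⊆ K
mainTheorem5 k 2≤k H H-sub Γk⊆H K (K-sub , n₀ , Γn₀⊆K) (_ , K⊆H , (g₀ , Hg₀ , g₀∉K) , maximal)
  with maximal (H ∩ K ·Γ suc k) (∩-isSubgroup H-sub (·Γ-isSubgroup K-sub))
               (λ g Kg → K⊆H g Kg , g , Kg , ∼-refl) (λ _ → proj₁)
... | inj₁ L⊆K = λ g γ → L⊆K g (Γk⊆H g (Γ-suc⊆ g γ) , ε , ε-closed K-sub , Γ⇒∼ε γ)
... | inj₂ H⊆L = ⊥-elim (g₀∉K (·Γ-collapses K-sub Γn₀⊆K 2≤k Γk⊆KΓ g₀ (proj₂ (H⊆L g₀ Hg₀))))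
  where
  Γk⊆KΓ : Γ k ⊆ K ·Γ suc k
  Γk⊆KΓ g = proj₂ ∘ H⊆L g ∘ Γk⊆H g
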